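{- Let $\Gamma,\Delta$ be finite multisets of formulas of intuitionistic propositional logic and $w$ a label. Every proof of the sequent $\Gamma\Rightarrow\Delta$ in $\mathsf{S(IL)}$ can be step-wise translated into a proof of the labeled sequent $w:\Gamma\Rightarrow w:\Delta$ in $\mathsf{L(IL)}$ (where $w:\Gamma=\{w:A\mid A\in\Gamma\}$).
   Context: Formulas: $A::=p\mid\bot\mid A\lor A\mid A\land A\mid A\supset A$. The sequent calculus $\mathsf{S(IL)}$ works on sequents $\Gamma\Rightarrow\Delta$ ($\Gamma,\Delta$ multisets of formulas) with rules: $(id)$: $\Gamma,p\Rightarrow p,\Delta$; $(\bot_l)$: $\Gamma,\bot\Rightarrow\Delta$; $(\lor_l)$: from $\Gamma,A\Rightarrow\Delta$ and $\Gamma,B\Rightarrow\Delta$ infer $\Gamma,A\lor B\Rightarrow\Delta$; $(\lor_r)$: from $\Gamma\Rightarrow A,B,\Delta$ infer $\Gamma\Rightarrow A\lor B,\Delta$; $(\land_l)$: from $\Gamma,A,B\Rightarrow\Delta$ infer $\Gamma,A\land B\Rightarrow\Delta$; $(\land_r)$: from $\Gamma\Rightarrow A,\Delta$ and $\Gamma\Rightarrow B,\Delta$ infer $\Gamma\Rightarrow A\land B,\Delta$; $(\supset_r)$: from $\Gamma,A\Rightarrow B$ infer $\Gamma\Rightarrow A\supset B,\Delta$; $(\supset_l)$: from $\Gamma,A\supset B,B\Rightarrow\Delta$ and $\Gamma,A\supset B\Rightarrow A,\Delta$ infer $\Gamma,A\supset B\Rightarrow\Delta$. The labeled calculus $\mathsf{L(IL)}$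 works on labeled sequents $\mathcal{R},\Gamma\Rightarrow\Delta$ where $\mathcal{R}$ is a multiset of relational atoms $w\leq u$ and $\Gamma,\Delta$ are multisets of labeled formulas $w:A$; its rules are: $(id)$: $\mathcal{R},w\leq u,\Gamma,w:p\Rightarrow u:p,\Delta$; $(\bot_l)$: $\mathcal{R},w\leq u,\Gamma,w:\bot\Rightarrow\Delta$; $(\supset_r)$: from $\mathcal{R},w\leq u,\Gamma,u:A\Rightarrow u:B,\Delta$ infer $\mathcal{R},\Gamma\Rightarrow w:A\supset B,\Delta$ with $u$ fresh; $(\lor_l)$: from $\mathcal{R},\Gamma,w:A\Rightarrow\Delta$ and $\mathcal{R},\Gamma,w:B\Rightarrow\Delta$ infer $\mathcal{R},\Gamma,w:A\lor B\Rightarrow\Delta$; $(\lor_r)$: from $\mathcal{R},\Gamma\Rightarrow w:A,w:B,\Delta$ infer $\mathcal{R},\Gamma\Rightarrow w:A\lor B,\Delta$; $(\land_l)$: from $\mathcal{R},\Gamma,w:A,w:B\Rightarrow\Delta$ infer $\mathcal{R},\Gamma,w:A\land B\Rightarrow\Delta$; $(\land_r)$: from $\mathcal{R},\Gamma\Rightarrow w:A,\Delta$ and $\mathcal{R},\Gamma\Rightarrow w:B,\Delta$ infer $\mathcal{R},\Gamma\Rightarrow w:A\land B,\Delta$; $(\supset_l)$: from $\mathcal{R},w\leq u,\Gamma,w:A\supset B,u:B\Rightarrow\Delta$ and $\mathcal{R},w\leq u,\Gamma,w:A\supset B\Rightarrow u:A,\Delta$ infer $\mathcal{R},w\leq u,\Gamma,w:A\supset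 B\Rightarrow\Delta$; $(ref)$: from $\mathcal{R},w\leq w,\Gamma\Rightarrow\Delta$ infer $\mathcal{R},\Gamma\Rightarrow\Delta$; $(tra)$: from $\mathcal{R},w\leq u,u\leq v,w\leq v,\Gamma\Rightarrow\Delta$ infer $\mathcal{R},w\leq u,u\leq v,\Gamma\Rightarrow\Delta$. -}

module Defs where

open import Data.Nat using (ℕ)
open import Data.Product using (_×_; _,_; proj₁; proj₂)
open import Data.List using (List; []; _∷_; map; _++_; concatMap)
open import Data.List.Membership.Propositional using (_∉_)
open import Data.List.Relation.Binary.Permutation.Propositional using (_↭_)

data Formula : Set where
  atom : ℕ → Formula
  ⊥′   : Formula
  _∨′_ : Formula → Formula → Formula
  _∧′_ : Formula → Formula → Formula
  _⊃_  : Formula → Formula → Formula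

-- Finite multisets are represented as lists; multiset identity is
-- recovered by the (exchange) constructors closing under permutation.

data S⊢ : List Formula → List Formula → Set where
  exch : ∀ {Γ Γ′ Δ Δ′} → Γ ↭ Γ′ → Δ ↭ Δ′ → S⊢ Γ Δ → S⊢ Γ′ Δ′
  id   : ∀ {Γ Δ} p → S⊢ (atom p ∷ Γ) (atom p ∷ Δ)
  ⊥l   : ∀ {Γ Δ} → S⊢ (⊥′ ∷ Γ) Δ
  ∨l   : ∀ {Γ Δ A B} → S⊢ (A ∷ Γ) Δ → S⊢ (B ∷ Γ) Δ → S⊢ ((A ∨′ B) ∷ Γ) Δ
  ∨r   : ∀ {Γ Δ A B} → S⊢ Γ (A ∷ B ∷ Δ) → S⊢ Γ ((A ∨′ B) ∷ Δ)
  ∧l   : ∀ {Γ Δ A B} → S⊢ (A ∷ B ∷ Γ) Δ → S⊢ ((A ∧′ B) ∷ Γ) Δ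
  ∧r   : ∀ {Γ Δ A B} → S⊢ Γ (A ∷ Δ) → S⊢ Γ (B ∷ Δ) → S⊢ Γ ((A ∧′ B) ∷ Δ)
  ⊃r   : ∀ {Γ Δ A B} → S⊢ (A ∷ Γ) (B ∷ []) → S⊢ Γ ((A ⊃ B) ∷ Δ)
  ⊃l   : ∀ {Γ Δ A B} → S⊢ ((A ⊃ B) ∷ B ∷ Γ) Δ → S⊢ ((A ⊃ B) ∷ Γ) (A ∷ Δ)
       → S⊢ ((A ⊃ B) ∷ Γ) Δ

Label : Set
Label = ℕ

-- relational atom w ≤ u, represented as the pair (w , u)
RelAtom : Set
RelAtom = Label × Label

LFormula : Set
LFormula = Label × Formula

_∶_ : Label → Formula → LFormula
w ∶ A = w , A

label : Label → List Formula → List LFormula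
label w Γ = map (w ∶_) Γ

labels : List RelAtom → List LFormula → List LFormula → List Label
labels R Γ Δ = concatMap (λ r → proj₁ r ∷ proj₂ r ∷ []) R ++ map proj₁ Γ ++ map proj₁ Δ

data L⊢ : List RelAtom → List LFormula → List LFormula → Set where
  exch : ∀ {R R′ Γ Γ′ Δ Δ′} → R ↭ R′ → Γ ↭ Γ′ → Δ ↭ Δ′ → L⊢ R Γ Δ → L⊢ R′ Γ′ Δ′
  id   : ∀ {R Γ Δ w u} p → L⊢ ((w , u) ∷ R) ((w ∶ atom p) ∷ Γ) ((u ∶ atom p) ∷ Δ)
  ⊥l   : ∀ {R Γ Δ w u} → L⊢ ((w , u) ∷ R) ((w ∶ ⊥′) ∷ Γ) Δ
  ⊃r   : ∀ {R Γ Δ w u A B} → u ∉ (w ∷ labels R Γ Δ)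
       → L⊢ ((w , u) ∷ R) ((u ∶ A) ∷ Γ) ((u ∶ B) ∷ Δ)
       → L⊢ R Γ ((w ∶ (A ⊃ B)) ∷ Δ)
  ∨l   : ∀ {R Γ Δ w A B} → L⊢ R ((w ∶ A) ∷ Γ) Δ → L⊢ R ((w ∶ B) ∷ Γ) Δ
       → L⊢ R ((w ∶ (A ∨′ B)) ∷ Γ) Δ
  ∨r   : ∀ {R Γ Δ w A B} → L⊢ R Γ ((w ∶ A) ∷ (w ∶ B) ∷ Δ) → L⊢ R Γ ((w ∶ (A ∨′ B)) ∷ Δ)
  ∧l   : ∀ {R Γ Δ w A B} → L⊢ R ((w ∶ A) ∷ (w ∶ B) ∷ Γ) Δ → L⊢ R ((w ∶ (A ∧′ B)) ∷ Γ) Δ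
  ∧r   : ∀ {R Γ Δ w A B} → L⊢ R Γ ((w ∶ A) ∷ Δ) → L⊢ R Γ ((w ∶ B) ∷ Δ)
       → L⊢ R Γ ((w ∶ (A ∧′ B)) ∷ Δ)
  ⊃l   : ∀ {R Γ Δ w u A B}
       → L⊢ ((w , u) ∷ R) ((w ∶ (A ⊃ B)) ∷ (u ∶ B) ∷ Γ) Δ
       → L⊢ ((w , u) ∷ R) ((w ∶ (A ⊃ B)) ∷ Γ) ((u ∶ A) ∷ Δ)
       → L⊢ ((w , u) ∷ R) ((w ∶ (A ⊃ B)) ∷ Γ) Δ
  ref  : ∀ {R Γ Δ w} → L⊢ ((w , w) ∷ R) Γ Δ → L⊢ R Γ Δ
  tra  : ∀ {R Γ Δ w u v} → L⊢ ((w , u) ∷ (u , v) ∷ (w , v) ∷ R) Γ Δ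
       → L⊢ ((w , u) ∷ (u , v) ∷ R) Γ Δ

{-# OPTIONS --safe #-}
module Submission where

-- An S(IL) proof of Γ ⇒ Δ is translated rule by rule into L(IL), with all of
-- Δ at a single world w but the antecedent allowed to sit at any worlds v
-- with v ≤ w in the relational context.  This invariant survives (⊃r): the
-- implication is opened at a fresh world u with w ≤ u, and every old
-- antecedent world v acquires v ≤ u by (tra) through w.  For (⊃l) the
-- successor world is w itself, made available by (ref); the axioms and
-- (⊃l) then fire at the atom v ≤ w wherever it occurs in the context.

open import Data.Nat using (ℕ; suc)
open import Data.Nat.Properties using (1+n≰n)
open import Data.Product using (_,_; proj₁; proj₂; ∃)
open import Data.List using (List; []; _∷_; map; _++_)
open import Data.List.Properties using (map-∘; map-id; ++-identityʳ)
open import Data.List.Extrema.Nat using (max; xs≤max)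
open import Data.List.Membership.Propositional using (_∈_; _∉_)
open import Data.List.Membership.Propositional.Properties using (∈-∃++; ∈-map⁺; ∈-++⁺ˡ; ∈-++⁺ʳ)
open import Data.List.Relation.Binary.Subset.Propositional using (_⊆_)
open import Data.List.Relation.Unary.Any using (here; there)
open import Data.List.Relation.Unary.All as All using (All; []; _∷_)
open import Data.List.Relation.Unary.All.Properties using () renaming (map⁺ to All-map⁺)
open import Data.List.Relation.Binary.Permutation.Propositional
  using (_↭_; ↭-refl; ↭-sym; ↭-trans; prep; swap)
open import Data.List.Relation.Binary.Permutation.Propositional.Properties
  using (shift; shifts; ↭-map-inv; All-resp-↭; ++⁺ʳ; map⁺)
open import Relation.Binary.PropositionalEquality using (_≡_; refl; sym; trans; subst)
open import Defs

fresh : (xs : List ℕ) → ∃ λ u → u ∉ xs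
fresh xs = suc (max 0 xs) , λ u∈xs → 1+n≰n (All.lookup (xs≤max 0 xs) u∈xs)

∈⇒↭∷ : ∀ {A : Set} {x : A} {xs} → x ∈ xs → ∃ λ ys → xs ↭ x ∷ ys
∈⇒↭∷ {x = x} x∈xs with ys , zs , refl ← ∈-∃++ x∈xs = ys ++ zs , shift x ys zs

exchᴿ : ∀ {R R′ Γ Δ} → R ↭ R′ → L⊢ R Γ Δ → L⊢ R′ Γ Δ
exchᴿ ρ = exch ρ ↭-refl ↭-refl

module _ {R : List RelAtom} {Γ Δ : List LFormula} where

  id-∈ : ∀ {w u} p → (w , u) ∈ R → L⊢ R ((w ∶ atom p) ∷ Γ) ((u ∶ atom p) ∷ Δ)
  id-∈ p w≤u with _ , ρ ← ∈⇒↭∷ w≤u = exchᴿ (↭-sym ρ) (id p)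

  ⊥l-∈ : ∀ {w u} → (w , u) ∈ R → L⊢ R ((w ∶ ⊥′) ∷ Γ) Δ
  ⊥l-∈ w≤u with _ , ρ ← ∈⇒↭∷ w≤u = exchᴿ (↭-sym ρ) ⊥l

  ⊃l-∈ : ∀ {w u A B} → (w , u) ∈ R
       → L⊢ R ((w ∶ (A ⊃ B)) ∷ (u ∶ B) ∷ Γ) Δ
       → L⊢ R ((w ∶ (A ⊃ B)) ∷ Γ) ((u ∶ A) ∷ Δ)
       → L⊢ R ((w ∶ (A ⊃ B)) ∷ Γ) Δ
  ⊃l-∈ w≤u d₁ d₂ with _ , ρ ← ∈⇒↭∷ w≤u =
    exchᴿ (↭-sym ρ) (⊃l (exchᴿ ρ d₁) (exchᴿ ρ d₂))

tra-∈ : ∀ {R Γ Δ v w u} → (v , w) ∈ R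
      → L⊢ ((v , u) ∷ (w , u) ∷ R) Γ Δ → L⊢ ((w , u) ∷ R) Γ Δ
tra-∈ {v = v} {w} {u} v≤w d with R′ , ρ ← ∈⇒↭∷ v≤w =
  exchᴿ (↭-sym front) (tra (exchᴿ (↭-trans (prep (v , u) front) back) d))
  where
  front : (w , u) ∷ _ ↭ (v , w) ∷ (w , u) ∷ R′
  front = ↭-trans (prep (w , u) ρ) (swap (w , u) (v , w) ↭-refl)
  back : (v , u) ∷ (v , w) ∷ (w , u) ∷ R′ ↭ (v , w) ∷ (w , u) ∷ (v , u) ∷ R′
  back = shifts ((v , u) ∷ []) ((v , w) ∷ (w , u) ∷ [])

Below : List RelAtom → Label → List LFormula → Set
Below R w G = All (λ x → (proj₁ x , w) ∈ R) G

Below-mono : ∀ {R R′ w G} → R ⊆ R′ → Below R w G → Below R′ w G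
Below-mono R⊆R′ = All.map R⊆R′

edgesTo : Label → List LFormula → List RelAtom
edgesTo u G = map (λ x → proj₁ x , u) G

Below-edgesTo : ∀ u G → Below (edgesTo u G) u G
Below-edgesTo u G = All.tabulate (∈-map⁺ _)

Below-label : ∀ {R w} Γ → (w , w) ∈ R → Below R w (label w Γ)
Below-label Γ w≤w = All-map⁺ (All.universal (λ _ → w≤w) Γ)

tra-edgesTo : ∀ {R Γ Δ w u} G → Below R w G
            → L⊢ ((w , u) ∷ edgesTo u G ++ R) Γ Δ → L⊢ ((w , u) ∷ R) Γ Δ
tra-edgesTo []      []            d = d
tra-edgesTo (_ ∷ G) (v≤w ∷ G≤w) d =
  tra-edgesTo G G≤w (tra-∈ (∈-++⁺ʳ (edgesTo _ G) v≤w) (exchᴿ (swap _ _ ↭-refl) d))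

-- The spare succedent E is where (⊃r), which discards Δ in S(IL), keeps it in L(IL).
translate : ∀ {Γ Δ} → S⊢ Γ Δ → ∀ {R w} G E → map proj₂ G ≡ Γ → Below R w G
          → L⊢ R G (label w Δ ++ E)
translate (exch ρΓ ρΔ d) {w = w} G E refl G≤w
  with G′ , refl , G↭G′ ← ↭-map-inv proj₂ (↭-sym ρΓ) =
  exch ↭-refl (↭-sym G↭G′) (++⁺ʳ E (map⁺ (w ∶_) ρΔ))
    (translate d G′ E refl (All-resp-↭ G↭G′ G≤w))
translate (id p)     (_ ∷ _) E refl (v≤w ∷ _) = id-∈ p v≤w
translate ⊥l         (_ ∷ _) E refl (v≤w ∷ _) = ⊥l-∈ v≤w
translate (∨l d₁ d₂) (_ ∷ _) E refl (v≤w ∷ G≤w) =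
  ∨l (translate d₁ _ E refl (v≤w ∷ G≤w)) (translate d₂ _ E refl (v≤w ∷ G≤w))
translate (∨r d)     G E eq G≤w = ∨r (translate d G E eq G≤w)
translate (∧l d)     (_ ∷ _) E refl (v≤w ∷ G≤w) =
  ∧l (translate d _ E refl (v≤w ∷ v≤w ∷ G≤w))
translate (∧r d₁ d₂) G E eq G≤w = ∧r (translate d₁ G E eq G≤w) (translate d₂ G E eq G≤w)
translate (⊃r {Δ = Δ} {A = A} d) {R} {w} G E refl G≤w
  with u , u∉ ← fresh (w ∷ labels R G (label w Δ ++ E)) =
  ⊃r u∉ (tra-edgesTo G G≤w (ref
    (translate d ((u ∶ A) ∷ G) (label w Δ ++ E) refl
      (here refl ∷ Below-mono (λ e → there (there (∈-++⁺ˡ e))) (Below-edgesTo u G)))))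
translate (⊃l d₁ d₂) {R} {w} (_ ∷ G) E refl (v≤w ∷ G≤w) =
  ref (⊃l-∈ (there v≤w)
    (translate d₁ _ E refl (there v≤w ∷ here refl ∷ G≤w′))
    (translate d₂ _ E refl (there v≤w ∷ G≤w′)))
  where
  G≤w′ : Below ((w , w) ∷ R) w G
  G≤w′ = Below-mono there G≤w

theorem3p9 : ∀ {Γ Δ} (w : Label) → S⊢ Γ Δ → L⊢ [] (label w Γ) (label w Δ)
theorem3p9 {Γ} {Δ} w d =
  ref (subst (L⊢ _ _) (++-identityʳ (label w Δ))
    (translate d (label w Γ) [] formulas (Below-label Γ (here refl))))
  where
  formulas : map proj₂ (label w Γ) ≡ Γ
  formulas = trans (sym (map-∘ Γ)) (map-id Γ)
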